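{- For every integer $n\ge 0$, $$\beta_{n,\lambda}(x)=\sum_{k=0}^{n}\frac{(-1)^{k}}{k+1}\,k!\,S_{2,\lambda}(n,k\,|\,x)=\sum_{k=0}^{n}\frac{1}{k+1}\sum_{l=0}^{k}\binom{k}{l}(-1)^{l}(l+x)_{n,\lambda}.$$
   Context: Let $\lambda\in\mathbb{R}$. $(x)_{0,\lambda}=1$, $(x)_{n,\lambda}=x(x-\lambda)\cdots(x-(n-1)\lambda)$ for $n\ge1$. $e_\lambda^x(t)=\sum_{k\ge0}(x)_{k,\lambda}t^k/k!$ (formal power series in $t$), $e_\lambda(t)=e_\lambda^1(t)$. The fully degenerate Bernoulli polynomials are defined by $\frac{\log(1+\lambda t)}{\lambda(e_\lambda(t)-1)}e_\lambda^x(t)=\sum_{n\ge0}\beta_{n,\lambda}(x)\frac{t^n}{n!}$ (for $\lambda=0$ interpret $\log(1+\lambda t)/\lambda$ as $t$ and $e_0^x(t)=e^{xt}$). For an integer $k\ge0$, the degenerate Stirling polynomials $S_{2,\lambda}(n,k\,|\,x)$ are defined by $\frac{1}{k!}(e_\lambda(t)-1)^k e_\lambda^x(t)=\sum_{n\ge k}S_{2,\lambda}(n,k\,|\,x)\frac{t^n}{n!}$.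
   Formalization: The parameter λ is taken over ℚ instead of ℝ, and the Bernoulli and Stirling polynomials are evaluated only at rational x. -}

module Defs where

open import Data.Nat using (ℕ; zero; suc; _∸_)
open import Data.Nat.Combinatorics using (_C_)
open import Data.Nat.Properties using ()
open import Data.Integer using (+_)
open import Data.Rational using (ℚ; _+_; _*_; -_; _-_; _/_; 0ℚ; 1ℚ)
open import Data.List using (List; []; _∷_)

ℕ→ℚ : ℕ → ℚ
ℕ→ℚ n = (+ n) / 1

recipSuc : ℕ → ℚ
recipSuc n = (+ 1) / suc n

fact : ℕ → ℕ
fact zero = 1
fact (suc n) = suc n Data.Nat.* fact n

recipFact : ℕ → ℚ
recipFact zero = 1ℚ
recipFact (suc n) = recipSuc n * recipFact n

pow : ℚ → ℕ → ℚ
pow q zero = 1ℚ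
pow q (suc n) = pow q n * q

sgn : ℕ → ℚ
sgn n = pow (- 1ℚ) n

sumTo : ℕ → (ℕ → ℚ) → ℚ
sumTo zero f = f 0
sumTo (suc n) f = sumTo n f + f (suc n)

dfall : ℚ → ℚ → ℕ → ℚ
dfall λ' x zero = 1ℚ
dfall λ' x (suc n) = dfall λ' x n * (x - ℕ→ℚ n * λ')

Series : Set
Series = ℕ → ℚ

_⊗_ : Series → Series → Series
(a ⊗ b) n = sumTo n (λ k → a k * b (n ∸ k))

oneS : Series
oneS zero = 1ℚ
oneS (suc n) = 0ℚ

powS : Series → ℕ → Series
powS a zero = oneS
powS a (suc k) = powS a k ⊗ a

-- Multiplicative inverse of a series with constant term 1.
-- invList a n = [g_n, g_{n-1}, ..., g_0], where g_0 = 1 and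
-- g_{m} = - Σ_{j=1}^{m} a_j g_{m-j}.
private
  accum : Series → ℕ → List ℚ → ℚ
  accum a j [] = 0ℚ
  accum a j (g ∷ gs) = a (suc j) * g + accum a (suc j) gs

invList : Series → ℕ → List ℚ
invList a zero = 1ℚ ∷ []
invList a (suc n) = (- accum a 0 (invList a n)) ∷ invList a n

invS : Series → Series
invS a n with invList a n
... | [] = 0ℚ
... | g ∷ _ = g

eλ : ℚ → ℚ → Series
eλ λ' x k = dfall λ' x k * recipFact k

eλm1 : ℚ → Series
eλm1 λ' zero = 0ℚ
eλm1 λ' (suc k) = eλ λ' 1ℚ (suc k)

-- (e_λ(t) - 1)/t  (constant term 1)
eλm1/t : ℚ → Series
eλm1/t λ' k = eλ λ' 1ℚ (suc k)

-- log(1+λt)/(λ t) = Σ_{n≥0} (-λ)^n t^n/(n+1)   (equals 1 when λ = 0)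
logq/t : ℚ → Series
logq/t λ' n = pow (- λ') n * recipSuc n

-- Fully degenerate Bernoulli polynomials:
-- log(1+λt)/(λ(e_λ(t)-1)) e_λ^x(t) = (log(1+λt)/(λt)) · (t/(e_λ(t)-1)) · e_λ^x(t)
β : ℚ → ℚ → ℕ → ℚ
β λ' x n = ℕ→ℚ (fact n) * ((logq/t λ' ⊗ invS (eλm1/t λ')) ⊗ eλ λ' x) n

S₂ : ℚ → ℕ → ℕ → ℚ → ℚ
S₂ λ' n k x = ℕ→ℚ (fact n) * (recipFact k * (powS (eλm1 λ') k ⊗ eλ λ' x) n)

{-# OPTIONS --safe #-}
-- Write U = e_λ(t) - 1. Formally e_λ(t) = (1 + λt)^(1/λ), so log(1 + λt)/λ = log(1 + U)
-- = Σ_k (-1)^k U^(k+1)/(k+1), and the Bernoulli generating function becomes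
-- Σ_k (-1)^k/(k+1) U^k e_λ^x(t). Since U^k = O(t^k), only k ≤ n contribute to the coefficient
-- of t^n, which gives the first identity. The logarithm expansion is checked without logarithms
-- by applying (1 + λt) d/dt to both sides: e_λ^x solves (1 + λt) F' = x F, so
-- (1 + λt) U' = 1 + U, and both sides become 1 modulo t^(n+1). The same differential equation
-- gives e_λ^a e_λ^b = e_λ^(a+b), so U^k e_λ^x = Σ_l C(k,l) (-1)^(k-l) e_λ^(l+x), and this gives
-- the second identity.
module Submission where

open import Defs
open import Data.Nat as ℕ using (ℕ; zero; suc; _≤_; _<_; _∸_; z≤n; s≤s)
import Data.Nat.Properties as ℕₚ
import Data.Nat.Coprimality as Coprime
open import Data.Nat.Combinatorics using (_C_; nCk+nC[k+1]≡[n+1]C[k+1]; k>n⇒nCk≡0)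
import Data.Integer as ℤ
import Data.Integer.Properties as ℤₚ
open import Data.Rational using (ℚ; mkℚ; _+_; _*_; -_; _-_; 0ℚ; 1ℚ; toℚᵘ)
import Data.Rational.Properties as ℚₚ
import Data.Rational.Unnormalised as ℚᵘ
import Data.Rational.Unnormalised.Properties as ℚᵘₚ
open import Data.Rational.Solver using (module +-*-Solver)
open +-*-Solver using (solve; _:+_; _:*_; _:-_; :-_; _:=_; con)
open import Algebra.Bundles using (CommutativeMonoid)
open import Algebra.Properties.Group ℚₚ.+-0-group using (∙-cancelʳ)
open import Algebra.Properties.CommutativeSemigroup
  (CommutativeMonoid.commutativeSemigroup ℚₚ.+-0-commutativeMonoid) using (interchange)
open import Algebra.Properties.CommutativeSemigroup
  (CommutativeMonoid.commutativeSemigroup ℚₚ.*-1-commutativeMonoid) using (x∙yz≈y∙xz; x∙yz≈zx∙y)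
open import Data.List using (List)
open import Data.Product using (_×_; _,_)
open import Relation.Binary.PropositionalEquality

ℕ→ℚ-toℚᵘ : ∀ n → toℚᵘ (ℕ→ℚ n) ≡ ℚᵘ.mkℚᵘ (ℤ.+ n) 0
ℕ→ℚ-toℚᵘ n = cong toℚᵘ (ℚₚ.normalize-coprime (Coprime.sym (Coprime.1-coprimeTo n)))

ℕ→ℚ-+ : ∀ m n → ℕ→ℚ (m ℕ.+ n) ≡ ℕ→ℚ m + ℕ→ℚ n
ℕ→ℚ-+ m n = ℚₚ.toℚᵘ-injective (begin
  toℚᵘ (ℕ→ℚ (m ℕ.+ n))                      ≡⟨ ℕ→ℚ-toℚᵘ (m ℕ.+ n) ⟩
  ℚᵘ.mkℚᵘ (ℤ.+ (m ℕ.+ n)) 0                 ≡⟨ cong₂ ℚᵘ.mkℚᵘ numerator refl ⟨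
  ℚᵘ.mkℚᵘ (ℤ.+ m) 0 ℚᵘ.+ ℚᵘ.mkℚᵘ (ℤ.+ n) 0 ≡⟨ cong₂ ℚᵘ._+_ (ℕ→ℚ-toℚᵘ m) (ℕ→ℚ-toℚᵘ n) ⟨
  toℚᵘ (ℕ→ℚ m) ℚᵘ.+ toℚᵘ (ℕ→ℚ n)           ≈⟨ ℚₚ.toℚᵘ-homo-+ (ℕ→ℚ m) (ℕ→ℚ n) ⟨
  toℚᵘ (ℕ→ℚ m + ℕ→ℚ n)                     ∎)
  where
  open ℚᵘₚ.≃-Reasoning
  numerator : ℤ.+ m ℤ.* ℤ.+ 1 ℤ.+ ℤ.+ n ℤ.* ℤ.+ 1 ≡ ℤ.+ (m ℕ.+ n)
  numerator = trans (cong₂ ℤ._+_ (ℤₚ.*-identityʳ (ℤ.+ m)) (ℤₚ.*-identityʳ (ℤ.+ n))) (ℤₚ.pos-+ m n)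

ℕ→ℚ-* : ∀ m n → ℕ→ℚ (m ℕ.* n) ≡ ℕ→ℚ m * ℕ→ℚ n
ℕ→ℚ-* m n = ℚₚ.toℚᵘ-injective (begin
  toℚᵘ (ℕ→ℚ (m ℕ.* n))                      ≡⟨ ℕ→ℚ-toℚᵘ (m ℕ.* n) ⟩
  ℚᵘ.mkℚᵘ (ℤ.+ (m ℕ.* n)) 0                 ≡⟨ cong₂ ℚᵘ.mkℚᵘ (ℤₚ.pos-* m n) refl ⟩
  ℚᵘ.mkℚᵘ (ℤ.+ m) 0 ℚᵘ.* ℚᵘ.mkℚᵘ (ℤ.+ n) 0 ≡⟨ cong₂ ℚᵘ._*_ (ℕ→ℚ-toℚᵘ m) (ℕ→ℚ-toℚᵘ n) ⟨
  toℚᵘ (ℕ→ℚ m) ℚᵘ.* toℚᵘ (ℕ→ℚ n)           ≈⟨ ℚₚ.toℚᵘ-homo-* (ℕ→ℚ m) (ℕ→ℚ n) ⟨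
  toℚᵘ (ℕ→ℚ m * ℕ→ℚ n)                     ∎)
  where open ℚᵘₚ.≃-Reasoning

ℕ→ℚ-suc : ∀ n → ℕ→ℚ (suc n) ≡ ℕ→ℚ n + 1ℚ
ℕ→ℚ-suc n = trans (cong ℕ→ℚ (ℕₚ.+-comm 1 n)) (ℕ→ℚ-+ n 1)

recipSuc-inverseˡ : ∀ n → recipSuc n * ℕ→ℚ (suc n) ≡ 1ℚ
recipSuc-inverseˡ n
  rewrite ℚₚ.normalize-coprime (Coprime.1-coprimeTo (suc n))
        | ℚₚ.normalize-coprime (Coprime.sym (Coprime.1-coprimeTo (suc n)))
  = ℚₚ.*-inverseˡ (mkℚ (ℤ.+ suc n) 0 (Coprime.sym (Coprime.1-coprimeTo (suc n))))

ℕ→ℚ-suc-cancelˡ : ∀ n {p q} → ℕ→ℚ (suc n) * p ≡ ℕ→ℚ (suc n) * q → p ≡ q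
ℕ→ℚ-suc-cancelˡ n {p} {q} eq = begin
  p                                   ≡⟨ undo p ⟨
  recipSuc n * (ℕ→ℚ (suc n) * p)      ≡⟨ cong (recipSuc n *_) eq ⟩
  recipSuc n * (ℕ→ℚ (suc n) * q)      ≡⟨ undo q ⟩
  q                                   ∎
  where
  open ≡-Reasoning
  undo : ∀ r → recipSuc n * (ℕ→ℚ (suc n) * r) ≡ r
  undo r = trans (sym (ℚₚ.*-assoc (recipSuc n) (ℕ→ℚ (suc n)) r))
                 (trans (cong (_* r) (recipSuc-inverseˡ n)) (ℚₚ.*-identityˡ r))

fact-recipFact : ∀ n → ℕ→ℚ (fact n) * recipFact n ≡ 1ℚ
fact-recipFact zero = refl
fact-recipFact (suc n) = begin
  ℕ→ℚ (suc n ℕ.* fact n) * (recipSuc n * recipFact n)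
    ≡⟨ cong (_* (recipSuc n * recipFact n)) (ℕ→ℚ-* (suc n) (fact n)) ⟩
  ℕ→ℚ (suc n) * ℕ→ℚ (fact n) * (recipSuc n * recipFact n)
    ≡⟨ regroup (ℕ→ℚ (suc n)) (ℕ→ℚ (fact n)) (recipSuc n) (recipFact n) ⟩
  (recipSuc n * ℕ→ℚ (suc n)) * (ℕ→ℚ (fact n) * recipFact n)
    ≡⟨ cong₂ _*_ (recipSuc-inverseˡ n) (fact-recipFact n) ⟩
  1ℚ ∎
  where
  open ≡-Reasoning
  regroup : ∀ a b c d → a * b * (c * d) ≡ (c * a) * (b * d)
  regroup = solve 4 (λ a b c d → a :* b :* (c :* d) := (c :* a) :* (b :* d)) refl

sumTo-cong≤ : ∀ n {f g : ℕ → ℚ} → (∀ k → k ≤ n → f k ≡ g k) → sumTo n f ≡ sumTo n g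
sumTo-cong≤ zero    f≡g = f≡g 0 z≤n
sumTo-cong≤ (suc n) f≡g =
  cong₂ _+_ (sumTo-cong≤ n (λ k k≤n → f≡g k (ℕₚ.m≤n⇒m≤1+n k≤n))) (f≡g (suc n) ℕₚ.≤-refl)

sumTo-cong : ∀ n {f g : ℕ → ℚ} → (∀ k → f k ≡ g k) → sumTo n f ≡ sumTo n g
sumTo-cong n f≡g = sumTo-cong≤ n (λ k _ → f≡g k)

sumTo-zero : ∀ n {f : ℕ → ℚ} → (∀ k → k ≤ n → f k ≡ 0ℚ) → sumTo n f ≡ 0ℚ
sumTo-zero zero    f≡0 = f≡0 0 z≤n
sumTo-zero (suc n) f≡0 =
  cong₂ _+_ (sumTo-zero n (λ k k≤n → f≡0 k (ℕₚ.m≤n⇒m≤1+n k≤n))) (f≡0 (suc n) ℕₚ.≤-refl)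

sumTo-+ : ∀ n (f g : ℕ → ℚ) → sumTo n (λ k → f k + g k) ≡ sumTo n f + sumTo n g
sumTo-+ zero    f g = refl
sumTo-+ (suc n) f g = trans (cong (_+ (f (suc n) + g (suc n))) (sumTo-+ n f g))
                            (interchange (sumTo n f) (sumTo n g) (f (suc n)) (g (suc n)))

sumTo-neg : ∀ n (f : ℕ → ℚ) → sumTo n (λ k → - f k) ≡ - sumTo n f
sumTo-neg zero    f = refl
sumTo-neg (suc n) f = trans (cong (_+ (- f (suc n))) (sumTo-neg n f))
                            (sym (ℚₚ.neg-distrib-+ (sumTo n f) (f (suc n))))

sumTo-- : ∀ n (f g : ℕ → ℚ) → sumTo n (λ k → f k - g k) ≡ sumTo n f - sumTo n g
sumTo-- n f g = trans (sumTo-+ n f (λ k → - g k)) (cong (sumTo n f +_) (sumTo-neg n g))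

sumTo-*ˡ : ∀ n c (f : ℕ → ℚ) → c * sumTo n f ≡ sumTo n (λ k → c * f k)
sumTo-*ˡ zero    c f = refl
sumTo-*ˡ (suc n) c f = trans (ℚₚ.*-distribˡ-+ c (sumTo n f) (f (suc n)))
                             (cong (_+ c * f (suc n)) (sumTo-*ˡ n c f))

sumTo-*ʳ : ∀ n c (f : ℕ → ℚ) → sumTo n f * c ≡ sumTo n (λ k → f k * c)
sumTo-*ʳ n c f = trans (ℚₚ.*-comm (sumTo n f) c)
                       (trans (sumTo-*ˡ n c f) (sumTo-cong n (λ k → ℚₚ.*-comm c (f k))))

sumTo-unfoldˡ : ∀ n (f : ℕ → ℚ) → sumTo (suc n) f ≡ f 0 + sumTo n (λ k → f (suc k))
sumTo-unfoldˡ zero    f = refl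
sumTo-unfoldˡ (suc n) f = trans (cong (_+ f (suc (suc n))) (sumTo-unfoldˡ n f))
                                (ℚₚ.+-assoc (f 0) _ _)

sumTo-reverse : ∀ n (f : ℕ → ℚ) → sumTo n f ≡ sumTo n (λ k → f (n ∸ k))
sumTo-reverse zero    f = refl
sumTo-reverse (suc n) f = begin
  sumTo n f + f (suc n)                             ≡⟨ cong (_+ f (suc n)) (sumTo-reverse n f) ⟩
  sumTo n (λ k → f (n ∸ k)) + f (suc n)             ≡⟨ ℚₚ.+-comm _ (f (suc n)) ⟩
  f (suc n) + sumTo n (λ k → f (n ∸ k))             ≡⟨ sumTo-unfoldˡ n (λ k → f (suc n ∸ k)) ⟨
  sumTo (suc n) (λ k → f (suc n ∸ k))               ∎
  where open ≡-Reasoning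

sumTo-swap : ∀ n m (f : ℕ → ℕ → ℚ) →
             sumTo n (λ i → sumTo m (f i)) ≡ sumTo m (λ j → sumTo n (λ i → f i j))
sumTo-swap zero    m f = refl
sumTo-swap (suc n) m f = trans (cong (_+ sumTo m (f (suc n))) (sumTo-swap n m f))
                               (sym (sumTo-+ m (λ j → sumTo n (λ i → f i j)) (f (suc n))))

sumTo-triangle : ∀ n (f : ℕ → ℕ → ℚ) →
                 sumTo n (λ i → sumTo i (f i)) ≡ sumTo n (λ j → sumTo (n ∸ j) (λ k → f (j ℕ.+ k) j))
sumTo-triangle zero    f = refl
sumTo-triangle (suc n) f = begin
  sumTo n (λ i → sumTo i (f i)) + sumTo (suc n) (f (suc n))
    ≡⟨ cong (_+ sumTo (suc n) (f (suc n))) (sumTo-triangle n f) ⟩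
  inner n + (sumTo n (f (suc n)) + f (suc n) (suc n))
    ≡⟨ ℚₚ.+-assoc (inner n) (sumTo n (f (suc n))) (f (suc n) (suc n)) ⟨
  (inner n + sumTo n (f (suc n))) + f (suc n) (suc n)
    ≡⟨ cong (_+ f (suc n) (suc n)) (sumTo-+ n (λ j → column n j) (f (suc n))) ⟨
  sumTo n (λ j → column n j + f (suc n) j) + f (suc n) (suc n)
    ≡⟨ cong₂ _+_ (sumTo-cong≤ n grow) diagonal ⟨
  inner (suc n) ∎
  where
  open ≡-Reasoning
  column : ℕ → ℕ → ℚ
  column r j = sumTo (r ∸ j) (λ k → f (j ℕ.+ k) j)
  inner : ℕ → ℚ
  inner r = sumTo r (column r)
  grow : ∀ j → j ≤ n → column (suc n) j ≡ column n j + f (suc n) j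
  grow j j≤n rewrite ℕₚ.+-∸-assoc 1 j≤n =
    cong (λ i → column n j + f i j) (trans (ℕₚ.+-suc j (n ∸ j)) (cong suc (ℕₚ.m+[n∸m]≡n j≤n)))
  diagonal : column (suc n) (suc n) ≡ f (suc n) (suc n)
  diagonal rewrite ℕₚ.n∸n≡0 n | ℕₚ.+-identityʳ n = refl

sumTo-alternating-telescope : ∀ K (g : ℕ → ℚ) →
  sumTo K (λ k → sgn k * (g k + g (suc k))) ≡ g 0 + sgn K * g (suc K)
sumTo-alternating-telescope zero    g =
  solve 2 (λ a b → con 1ℚ :* (a :+ b) := a :+ con 1ℚ :* b) refl (g 0) (g 1)
sumTo-alternating-telescope (suc K) g = begin
  sumTo K (λ k → sgn k * (g k + g (suc k))) + sgn K * (- 1ℚ) * (g (suc K) + g (suc (suc K)))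
    ≡⟨ cong (_+ sgn K * (- 1ℚ) * (g (suc K) + g (suc (suc K)))) (sumTo-alternating-telescope K g) ⟩
  g 0 + sgn K * g (suc K) + sgn K * (- 1ℚ) * (g (suc K) + g (suc (suc K)))
    ≡⟨ cancel (g 0) (sgn K) (g (suc K)) (g (suc (suc K))) ⟩
  g 0 + sgn K * (- 1ℚ) * g (suc (suc K)) ∎
  where
  open ≡-Reasoning
  cancel : ∀ a s b c → a + s * b + s * (- 1ℚ) * (b + c) ≡ a + s * (- 1ℚ) * c
  cancel = solve 4 (λ a s b c → a :+ s :* b :+ s :* con (- 1ℚ) :* (b :+ c)
                                := a :+ s :* con (- 1ℚ) :* c) refl

infix  4 _≋_ _≋[_]_
infixl 6 _⊕_ _⊖_
infixl 7 _·_

_≋_ : Series → Series → Set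
a ≋ b = ∀ m → a m ≡ b m

_≋[_]_ : Series → ℕ → Series → Set
a ≋[ N ] b = ∀ m → m ≤ N → a m ≡ b m

≋⇒≋[] : ∀ {a b} N → a ≋ b → a ≋[ N ] b
≋⇒≋[] N a≋b m _ = a≋b m

≋-trans : ∀ {a b c} → a ≋ b → b ≋ c → a ≋ c
≋-trans a≋b b≋c m = trans (a≋b m) (b≋c m)

_⊕_ : Series → Series → Series
(a ⊕ b) m = a m + b m

_⊖_ : Series → Series → Series
(a ⊖ b) m = a m - b m

_·_ : ℚ → Series → Series
(c · a) m = c * a m

sumS : ℕ → (ℕ → Series) → Series
sumS K A m = sumTo K (λ k → A k m)

shift : Series → Series
shift a zero    = 0ℚ
shift a (suc m) = a m

D : Series → Series
D a m = ℕ→ℚ (suc m) * a (suc m)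

⊗-cong≤ : ∀ N {a a′ b b′} → a ≋[ N ] a′ → b ≋[ N ] b′ → (a ⊗ b) ≋[ N ] (a′ ⊗ b′)
⊗-cong≤ N a≋a′ b≋b′ m m≤N = sumTo-cong≤ m (λ k k≤m →
  cong₂ _*_ (a≋a′ k (ℕₚ.≤-trans k≤m m≤N)) (b≋b′ (m ∸ k) (ℕₚ.≤-trans (ℕₚ.m∸n≤m m k) m≤N)))

⊗-congʳ≤ : ∀ N b {a a′} → a ≋[ N ] a′ → (a ⊗ b) ≋[ N ] (a′ ⊗ b)
⊗-congʳ≤ N b a≋a′ = ⊗-cong≤ N {b = b} {b′ = b} a≋a′ (λ _ _ → refl)

⊗-cong : ∀ {a a′ b b′} → a ≋ a′ → b ≋ b′ → (a ⊗ b) ≋ (a′ ⊗ b′)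
⊗-cong a≋a′ b≋b′ m = ⊗-cong≤ m (≋⇒≋[] m a≋a′) (≋⇒≋[] m b≋b′) m ℕₚ.≤-refl

⊗-congˡ : ∀ a {b b′} → b ≋ b′ → (a ⊗ b) ≋ (a ⊗ b′)
⊗-congˡ a = ⊗-cong {a} (λ _ → refl)

⊗-congʳ : ∀ b {a a′} → a ≋ a′ → (a ⊗ b) ≋ (a′ ⊗ b)
⊗-congʳ b a≋a′ = ⊗-cong {b = b} a≋a′ (λ _ → refl)

⊗-comm : ∀ a b → (a ⊗ b) ≋ (b ⊗ a)
⊗-comm a b m = trans (sumTo-reverse m (λ k → a k * b (m ∸ k)))
  (sumTo-cong≤ m (λ k k≤m → trans (cong (λ i → a (m ∸ k) * b i) (ℕₚ.m∸[m∸n]≡n k≤m))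
                                   (ℚₚ.*-comm (a (m ∸ k)) (b k))))

⊗-assoc : ∀ a b c → ((a ⊗ b) ⊗ c) ≋ (a ⊗ (b ⊗ c))
⊗-assoc a b c m = begin
  sumTo m (λ i → sumTo i (λ j → a j * b (i ∸ j)) * c (m ∸ i))
    ≡⟨ sumTo-cong m (λ i → sumTo-*ʳ i (c (m ∸ i)) (λ j → a j * b (i ∸ j))) ⟩
  sumTo m (λ i → sumTo i (λ j → a j * b (i ∸ j) * c (m ∸ i)))
    ≡⟨ sumTo-triangle m (λ i j → a j * b (i ∸ j) * c (m ∸ i)) ⟩
  sumTo m (λ j → sumTo (m ∸ j) (λ k → a j * b (j ℕ.+ k ∸ j) * c (m ∸ (j ℕ.+ k))))
    ≡⟨ sumTo-cong m (λ j → sumTo-cong (m ∸ j) (λ k → trans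
         (cong₂ (λ u v → a j * b u * c v) (ℕₚ.m+n∸m≡n j k) (sym (ℕₚ.∸-+-assoc m j k)))
         (ℚₚ.*-assoc (a j) (b k) (c (m ∸ j ∸ k))))) ⟩
  sumTo m (λ j → sumTo (m ∸ j) (λ k → a j * (b k * c (m ∸ j ∸ k))))
    ≡⟨ sumTo-cong m (λ j → sumTo-*ˡ (m ∸ j) (a j) (λ k → b k * c (m ∸ j ∸ k))) ⟨
  sumTo m (λ j → a j * sumTo (m ∸ j) (λ k → b k * c (m ∸ j ∸ k))) ∎
  where open ≡-Reasoning

⊗-identityˡ : ∀ a → (oneS ⊗ a) ≋ a
⊗-identityˡ a zero    = ℚₚ.*-identityˡ (a 0)
⊗-identityˡ a (suc m) = begin
  sumTo (suc m) (λ k → oneS k * a (suc m ∸ k))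
    ≡⟨ sumTo-unfoldˡ m (λ k → oneS k * a (suc m ∸ k)) ⟩
  1ℚ * a (suc m) + sumTo m (λ k → 0ℚ * a (m ∸ k))
    ≡⟨ cong₂ _+_ (ℚₚ.*-identityˡ (a (suc m))) (sumTo-zero m (λ k _ → ℚₚ.*-zeroˡ (a (m ∸ k)))) ⟩
  a (suc m) + 0ℚ
    ≡⟨ ℚₚ.+-identityʳ (a (suc m)) ⟩
  a (suc m) ∎
  where open ≡-Reasoning

⊗-identityʳ : ∀ a → (a ⊗ oneS) ≋ a
⊗-identityʳ a = ≋-trans (⊗-comm a oneS) (⊗-identityˡ a)

⊗-distribʳ-⊕ : ∀ a b c → ((a ⊕ b) ⊗ c) ≋ (a ⊗ c ⊕ b ⊗ c)
⊗-distribʳ-⊕ a b c m = trans (sumTo-cong m (λ k → ℚₚ.*-distribʳ-+ (c (m ∸ k)) (a k) (b k)))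
                             (sumTo-+ m (λ k → a k * c (m ∸ k)) (λ k → b k * c (m ∸ k)))

⊗-distribʳ-⊖ : ∀ a b c → ((a ⊖ b) ⊗ c) ≋ (a ⊗ c ⊖ b ⊗ c)
⊗-distribʳ-⊖ a b c m = trans (sumTo-cong m (λ k → *-distribʳ-- (a k) (b k) (c (m ∸ k))))
                             (sumTo-- m (λ k → a k * c (m ∸ k)) (λ k → b k * c (m ∸ k)))
  where
  *-distribʳ-- : ∀ x y z → (x - y) * z ≡ x * z - y * z
  *-distribʳ-- = solve 3 (λ x y z → (x :- y) :* z := x :* z :- y :* z) refl

⊗-distribˡ-⊕ : ∀ a b c → (a ⊗ (b ⊕ c)) ≋ (a ⊗ b ⊕ a ⊗ c)
⊗-distribˡ-⊕ a b c = ≋-trans (⊗-comm a (b ⊕ c)) (≋-trans (⊗-distribʳ-⊕ b c a)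
  (λ m → cong₂ _+_ (⊗-comm b a m) (⊗-comm c a m)))

⊗-distribˡ-⊖ : ∀ a b c → (a ⊗ (b ⊖ c)) ≋ (a ⊗ b ⊖ a ⊗ c)
⊗-distribˡ-⊖ a b c = ≋-trans (⊗-comm a (b ⊖ c)) (≋-trans (⊗-distribʳ-⊖ b c a)
  (λ m → cong₂ _-_ (⊗-comm b a m) (⊗-comm c a m)))

·-⊗ : ∀ s a b → ((s · a) ⊗ b) ≋ (s · (a ⊗ b))
·-⊗ s a b m = trans (sumTo-cong m (λ k → ℚₚ.*-assoc s (a k) (b (m ∸ k))))
                    (sym (sumTo-*ˡ m s (λ k → a k * b (m ∸ k))))

⊗-· : ∀ s a b → (a ⊗ (s · b)) ≋ (s · (a ⊗ b))
⊗-· s a b = ≋-trans (⊗-comm a (s · b)) (≋-trans (·-⊗ s b a) (λ m → cong (s *_) (⊗-comm b a m)))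

sumS-⊗ : ∀ K A b → (sumS K A ⊗ b) ≋ sumS K (λ k → A k ⊗ b)
sumS-⊗ K A b m = begin
  sumTo m (λ j → sumTo K (λ k → A k j) * b (m ∸ j))
    ≡⟨ sumTo-cong m (λ j → sumTo-*ʳ K (b (m ∸ j)) (λ k → A k j)) ⟩
  sumTo m (λ j → sumTo K (λ k → A k j * b (m ∸ j)))
    ≡⟨ sumTo-swap m K (λ j k → A k j * b (m ∸ j)) ⟩
  sumTo K (λ k → (A k ⊗ b) m) ∎
  where open ≡-Reasoning

shift-⊗ : ∀ a b → (a ⊗ shift b) ≋ shift (a ⊗ b)
shift-⊗ a b zero    = ℚₚ.*-zeroʳ (a 0)
shift-⊗ a b (suc m) = begin
  sumTo m (λ k → a k * shift b (suc m ∸ k)) + a (suc m) * shift b (suc m ∸ suc m)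
    ≡⟨ cong₂ _+_ (sumTo-cong≤ m (λ k k≤m → cong (λ i → a k * shift b i) (ℕₚ.+-∸-assoc 1 k≤m))) last ⟩
  sumTo m (λ k → a k * b (m ∸ k)) + 0ℚ
    ≡⟨ ℚₚ.+-identityʳ _ ⟩
  sumTo m (λ k → a k * b (m ∸ k)) ∎
  where
  open ≡-Reasoning
  last : a (suc m) * shift b (suc m ∸ suc m) ≡ 0ℚ
  last rewrite ℕₚ.n∸n≡0 m = ℚₚ.*-zeroʳ (a (suc m))

D-cong : ∀ {a b} → a ≋ b → D a ≋ D b
D-cong a≋b m = cong (ℕ→ℚ (suc m) *_) (a≋b (suc m))

D-· : ∀ s a → D (s · a) ≋ (s · D a)
D-· s a m = x∙yz≈y∙xz (ℕ→ℚ (suc m)) s (a (suc m))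

D-sumS : ∀ K A → D (sumS K A) ≋ sumS K (λ k → D (A k))
D-sumS K A m = sumTo-*ˡ K (ℕ→ℚ (suc m)) (λ k → A k (suc m))

D-⊗ : ∀ a b → D (a ⊗ b) ≋ (D a ⊗ b ⊕ a ⊗ D b)
D-⊗ a b m = begin
  ℕ→ℚ (suc m) * sumTo (suc m) f
    ≡⟨ sumTo-*ˡ (suc m) (ℕ→ℚ (suc m)) f ⟩
  sumTo (suc m) (λ k → ℕ→ℚ (suc m) * f k)
    ≡⟨ sumTo-cong≤ (suc m) split ⟩
  sumTo (suc m) (λ k → ℕ→ℚ k * f k + ℕ→ℚ (suc m ∸ k) * f k)
    ≡⟨ sumTo-+ (suc m) (λ k → ℕ→ℚ k * f k) (λ k → ℕ→ℚ (suc m ∸ k) * f k) ⟩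
  sumTo (suc m) (λ k → ℕ→ℚ k * f k) + sumTo (suc m) (λ k → ℕ→ℚ (suc m ∸ k) * f k)
    ≡⟨ cong₂ _+_ left right ⟩
  (D a ⊗ b) m + (a ⊗ D b) m ∎
  where
  open ≡-Reasoning
  f : ℕ → ℚ
  f k = a k * b (suc m ∸ k)
  split : ∀ k → k ≤ suc m → ℕ→ℚ (suc m) * f k ≡ ℕ→ℚ k * f k + ℕ→ℚ (suc m ∸ k) * f k
  split k k≤ = begin
    ℕ→ℚ (suc m) * f k                       ≡⟨ cong (λ i → ℕ→ℚ i * f k) (ℕₚ.m+[n∸m]≡n k≤) ⟨
    ℕ→ℚ (k ℕ.+ (suc m ∸ k)) * f k           ≡⟨ cong (_* f k) (ℕ→ℚ-+ k (suc m ∸ k)) ⟩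
    (ℕ→ℚ k + ℕ→ℚ (suc m ∸ k)) * f k         ≡⟨ ℚₚ.*-distribʳ-+ (f k) (ℕ→ℚ k) (ℕ→ℚ (suc m ∸ k)) ⟩
    ℕ→ℚ k * f k + ℕ→ℚ (suc m ∸ k) * f k     ∎
  left : sumTo (suc m) (λ k → ℕ→ℚ k * f k) ≡ (D a ⊗ b) m
  left = begin
    sumTo (suc m) (λ k → ℕ→ℚ k * f k)
      ≡⟨ sumTo-unfoldˡ m (λ k → ℕ→ℚ k * f k) ⟩
    0ℚ * f 0 + sumTo m (λ k → ℕ→ℚ (suc k) * (a (suc k) * b (m ∸ k)))
      ≡⟨ cong₂ _+_ (ℚₚ.*-zeroˡ (f 0))
           (sumTo-cong m (λ k → sym (ℚₚ.*-assoc (ℕ→ℚ (suc k)) (a (suc k)) (b (m ∸ k))))) ⟩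
    0ℚ + (D a ⊗ b) m
      ≡⟨ ℚₚ.+-identityˡ _ ⟩
    (D a ⊗ b) m ∎
  right : sumTo (suc m) (λ k → ℕ→ℚ (suc m ∸ k) * f k) ≡ (a ⊗ D b) m
  right = trans (cong₂ _+_ (sumTo-cong≤ m inner) last) (ℚₚ.+-identityʳ _)
    where
    inner : ∀ k → k ≤ m → ℕ→ℚ (suc m ∸ k) * f k ≡ a k * D b (m ∸ k)
    inner k k≤ rewrite ℕₚ.+-∸-assoc 1 k≤ = x∙yz≈y∙xz (ℕ→ℚ (suc (m ∸ k))) (a k) (b (suc (m ∸ k)))
    last : ℕ→ℚ (suc m ∸ suc m) * f (suc m) ≡ 0ℚ
    last rewrite ℕₚ.n∸n≡0 m = ℚₚ.*-zeroˡ (a (suc m) * b 0)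

D-powS : ∀ a k → D (powS a (suc k)) ≋ (ℕ→ℚ (suc k) · (powS a k ⊗ D a))
D-powS a zero m = begin
  D (oneS ⊗ a) m                  ≡⟨ D-cong (⊗-identityˡ a) m ⟩
  D a m                           ≡⟨ ⊗-identityˡ (D a) m ⟨
  (oneS ⊗ D a) m                  ≡⟨ ℚₚ.*-identityˡ _ ⟨
  1ℚ * (oneS ⊗ D a) m             ∎
  where open ≡-Reasoning
D-powS a (suc k) m = begin
  D (P ⊗ a) m
    ≡⟨ D-⊗ P a m ⟩
  (D P ⊗ a) m + (P ⊗ D a) m
    ≡⟨ cong (_+ (P ⊗ D a) m) (⊗-congʳ a (D-powS a k) m) ⟩
  ((ℕ→ℚ (suc k) · (powS a k ⊗ D a)) ⊗ a) m + (P ⊗ D a) m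
    ≡⟨ cong (_+ (P ⊗ D a) m) (·-⊗ (ℕ→ℚ (suc k)) (powS a k ⊗ D a) a m) ⟩
  ℕ→ℚ (suc k) * ((powS a k ⊗ D a) ⊗ a) m + (P ⊗ D a) m
    ≡⟨ cong (λ z → ℕ→ℚ (suc k) * z + (P ⊗ D a) m) move-D ⟩
  ℕ→ℚ (suc k) * (P ⊗ D a) m + (P ⊗ D a) m
    ≡⟨ count (ℕ→ℚ (suc k)) ((P ⊗ D a) m) ⟩
  (ℕ→ℚ (suc k) + 1ℚ) * (P ⊗ D a) m
    ≡⟨ cong (_* (P ⊗ D a) m) (ℕ→ℚ-suc (suc k)) ⟨
  ℕ→ℚ (suc (suc k)) * (P ⊗ D a) m ∎
  where
  open ≡-Reasoning
  P : Series
  P = powS a (suc k)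
  move-D : ((powS a k ⊗ D a) ⊗ a) m ≡ (P ⊗ D a) m
  move-D = trans (⊗-assoc (powS a k) (D a) a m)
           (trans (⊗-congˡ (powS a k) (⊗-comm (D a) a) m) (sym (⊗-assoc (powS a k) a (D a) m)))
  count : ∀ n y → n * y + y ≡ (n + 1ℚ) * y
  count = solve 2 (λ n y → n :* y :+ y := (n :+ con 1ℚ) :* y) refl

D-lift : ∀ N {a b} → a 0 ≡ b 0 → D a ≋[ N ] D b → a ≋[ suc N ] b
D-lift N a₀≡b₀ Da≋Db zero    _         = a₀≡b₀
D-lift N a₀≡b₀ Da≋Db (suc m) (s≤s m≤N) = ℕ→ℚ-suc-cancelˡ m (Da≋Db m m≤N)

⊗-vanish : ∀ p a b → (∀ j → j < p → a j ≡ 0ℚ) → ∀ m → m < p → (a ⊗ b) m ≡ 0ℚ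
⊗-vanish p a b a≡0 m m<p = sumTo-zero m (λ i i≤m →
  trans (cong (_* b (m ∸ i)) (a≡0 i (ℕₚ.≤-<-trans i≤m m<p))) (ℚₚ.*-zeroˡ (b (m ∸ i))))

powS-vanish : ∀ a → a 0 ≡ 0ℚ → ∀ k m → m < k → powS a k m ≡ 0ℚ
powS-vanish a a₀≡0 (suc k) m m<1+k =
  trans (⊗-congˡ (powS a k) a≋shift m) (trans (shift-⊗ (powS a k) a⁺ m) (low m m<1+k))
  where
  a⁺ : Series
  a⁺ m = a (suc m)
  a≋shift : a ≋ shift a⁺
  a≋shift zero    = a₀≡0
  a≋shift (suc m) = refl
  low : ∀ m → m < suc k → shift (powS a k ⊗ a⁺) m ≡ 0ℚ
  low zero    _         = refl
  low (suc m) (s≤s m<k) = ⊗-vanish k (powS a k) a⁺ (powS-vanish a a₀≡0 k) m m<k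

-- Defs keeps the accumulator of invList private. Here the meta is solved to it by unification
-- against the reduct of invS, once the arguments are generalised to variables. The
-- defining equations of accum then hold definitionally.
mutual
  accum : Series → ℕ → List ℚ → ℚ
  accum = _

  invS-suc : ∀ a m → invS a (suc m) ≡ - accum a 0 (invList a m)
  invS-suc a m with invList a m | 0
  ... | gs | j = refl

accum-invList : ∀ a m j → accum a j (invList a m) ≡ sumTo m (λ i → a (suc (i ℕ.+ j)) * invS a (m ∸ i))
accum-invList a zero    j = ℚₚ.+-identityʳ (a (suc j) * 1ℚ)
accum-invList a (suc m) j = begin
  a (suc j) * invS a (suc m) + accum a (suc j) (invList a m)
    ≡⟨ cong (a (suc j) * invS a (suc m) +_) (accum-invList a m (suc j)) ⟩
  a (suc j) * invS a (suc m) + sumTo m (λ i → a (suc (i ℕ.+ suc j)) * invS a (m ∸ i))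
    ≡⟨ cong (a (suc j) * invS a (suc m) +_)
         (sumTo-cong m (λ i → cong (λ r → a (suc r) * invS a (m ∸ i)) (ℕₚ.+-suc i j))) ⟩
  a (suc j) * invS a (suc m) + sumTo m (λ i → a (suc (suc i ℕ.+ j)) * invS a (m ∸ i))
    ≡⟨ sumTo-unfoldˡ m (λ i → a (suc (i ℕ.+ j)) * invS a (suc m ∸ i)) ⟨
  sumTo (suc m) (λ i → a (suc (i ℕ.+ j)) * invS a (suc m ∸ i)) ∎
  where open ≡-Reasoning

invS-inverseʳ : ∀ a → a 0 ≡ 1ℚ → (a ⊗ invS a) ≋ oneS
invS-inverseʳ a a₀≡1 zero    = cong (_* 1ℚ) a₀≡1
invS-inverseʳ a a₀≡1 (suc m) = begin
  sumTo (suc m) (λ k → a k * invS a (suc m ∸ k))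
    ≡⟨ sumTo-unfoldˡ m (λ k → a k * invS a (suc m ∸ k)) ⟩
  a 0 * invS a (suc m) + sumTo m (λ k → a (suc k) * invS a (m ∸ k))
    ≡⟨ cong₂ _+_ (trans (cong₂ _*_ a₀≡1 (invS-suc a m)) (ℚₚ.*-identityˡ (- acc))) (sym tail) ⟩
  - acc + acc
    ≡⟨ ℚₚ.+-inverseˡ acc ⟩
  0ℚ ∎
  where
  open ≡-Reasoning
  acc : ℚ
  acc = accum a 0 (invList a m)
  tail : acc ≡ sumTo m (λ k → a (suc k) * invS a (m ∸ k))
  tail = trans (accum-invList a m 0)
               (sumTo-cong m (λ i → cong (λ r → a (suc r) * invS a (m ∸ i)) (ℕₚ.+-identityʳ i)))

altBinomSum : (ℚ → ℚ) → ℕ → ℚ → ℚ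
altBinomSum f k x = sumTo k (λ l → ℕ→ℚ (k C l) * sgn l * f (ℕ→ℚ l + x))

altBinomSum-suc : ∀ f k x → altBinomSum f (suc k) x ≡ altBinomSum f k x - altBinomSum f k (1ℚ + x)
altBinomSum-suc f k x = begin
  sumTo (suc k) (term (suc k) x)
    ≡⟨ sumTo-unfoldˡ k (term (suc k) x) ⟩
  term k x 0 + sumTo k (λ l → term (suc k) x (suc l))
    ≡⟨ cong (term k x 0 +_) (trans (sumTo-cong k pascal) (sumTo-- k (λ l → term k x (suc l)) (term k (1ℚ + x)))) ⟩
  term k x 0 + (sumTo k (λ l → term k x (suc l)) - altBinomSum f k (1ℚ + x))
    ≡⟨ +-assoc-- (term k x 0) _ _ ⟩
  (term k x 0 + sumTo k (λ l → term k x (suc l))) - altBinomSum f k (1ℚ + x)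
    ≡⟨ cong (_- altBinomSum f k (1ℚ + x)) (sumTo-unfoldˡ k (term k x)) ⟨
  (altBinomSum f k x + term k x (suc k)) - altBinomSum f k (1ℚ + x)
    ≡⟨ cong (λ z → (altBinomSum f k x + z) - altBinomSum f k (1ℚ + x)) beyond ⟩
  (altBinomSum f k x + 0ℚ) - altBinomSum f k (1ℚ + x)
    ≡⟨ cong (_- altBinomSum f k (1ℚ + x)) (ℚₚ.+-identityʳ (altBinomSum f k x)) ⟩
  altBinomSum f k x - altBinomSum f k (1ℚ + x) ∎
  where
  open ≡-Reasoning
  term : ℕ → ℚ → ℕ → ℚ
  term k x l = ℕ→ℚ (k C l) * sgn l * f (ℕ→ℚ l + x)
  +-assoc-- : ∀ a b c → a + (b - c) ≡ (a + b) - c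
  +-assoc-- = solve 3 (λ a b c → a :+ (b :- c) := (a :+ b) :- c) refl
  split : ∀ A B s v → (A + B) * (s * (- 1ℚ)) * v ≡ B * (s * (- 1ℚ)) * v - A * s * v
  split = solve 4 (λ A B s v → (A :+ B) :* (s :* con (- 1ℚ)) :* v
                               := B :* (s :* con (- 1ℚ)) :* v :- A :* s :* v) refl
  pascal : ∀ l → term (suc k) x (suc l) ≡ term k x (suc l) - term k (1ℚ + x) l
  pascal l = begin
    ℕ→ℚ (suc k C suc l) * (sgn l * (- 1ℚ)) * v
      ≡⟨ cong (λ i → ℕ→ℚ i * (sgn l * (- 1ℚ)) * v) (nCk+nC[k+1]≡[n+1]C[k+1] k l) ⟨
    ℕ→ℚ (k C l ℕ.+ k C suc l) * (sgn l * (- 1ℚ)) * v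
      ≡⟨ cong (λ z → z * (sgn l * (- 1ℚ)) * v) (ℕ→ℚ-+ (k C l) (k C suc l)) ⟩
    (ℕ→ℚ (k C l) + ℕ→ℚ (k C suc l)) * (sgn l * (- 1ℚ)) * v
      ≡⟨ split (ℕ→ℚ (k C l)) (ℕ→ℚ (k C suc l)) (sgn l) v ⟩
    term k x (suc l) - ℕ→ℚ (k C l) * sgn l * f (ℕ→ℚ (suc l) + x)
      ≡⟨ cong (λ z → term k x (suc l) - ℕ→ℚ (k C l) * sgn l * f z) shift-argument ⟩
    term k x (suc l) - term k (1ℚ + x) l ∎
    where
    v : ℚ
    v = f (ℕ→ℚ (suc l) + x)
    shift-argument : ℕ→ℚ (suc l) + x ≡ ℕ→ℚ l + (1ℚ + x)
    shift-argument = trans (cong (_+ x) (ℕ→ℚ-suc l)) (ℚₚ.+-assoc (ℕ→ℚ l) 1ℚ x)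
  beyond : term k x (suc k) ≡ 0ℚ
  beyond = begin
    ℕ→ℚ (k C suc k) * sgn (suc k) * f (ℕ→ℚ (suc k) + x)
      ≡⟨ cong (λ i → ℕ→ℚ i * sgn (suc k) * f (ℕ→ℚ (suc k) + x)) (k>n⇒nCk≡0 (ℕₚ.n<1+n k)) ⟩
    0ℚ * sgn (suc k) * f (ℕ→ℚ (suc k) + x)
      ≡⟨ cong (_* f (ℕ→ℚ (suc k) + x)) (ℚₚ.*-zeroˡ (sgn (suc k))) ⟩
    0ℚ * f (ℕ→ℚ (suc k) + x)
      ≡⟨ ℚₚ.*-zeroˡ (f (ℕ→ℚ (suc k) + x)) ⟩
    0ℚ ∎

module _ (λ' : ℚ) where

  1+λt : Series
  1+λt zero          = 1ℚ
  1+λt (suc zero)    = λ'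
  1+λt (suc (suc _)) = 0ℚ

  1+λt-⊗-zero : ∀ a → (1+λt ⊗ a) 0 ≡ a 0
  1+λt-⊗-zero a = ℚₚ.*-identityˡ (a 0)

  1+λt-⊗-suc : ∀ a m → (1+λt ⊗ a) (suc m) ≡ a (suc m) + λ' * a m
  1+λt-⊗-suc a m = trans (sumTo-unfoldˡ m (λ k → 1+λt k * a (suc m ∸ k)))
                         (cong₂ _+_ (ℚₚ.*-identityˡ (a (suc m))) (linear m))
    where
    linear : ∀ m → sumTo m (λ k → 1+λt (suc k) * a (m ∸ k)) ≡ λ' * a m
    linear zero    = refl
    linear (suc m) = begin
      sumTo (suc m) (λ k → 1+λt (suc k) * a (suc m ∸ k))
        ≡⟨ sumTo-unfoldˡ m (λ k → 1+λt (suc k) * a (suc m ∸ k)) ⟩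
      λ' * a (suc m) + sumTo m (λ k → 0ℚ * a (m ∸ k))
        ≡⟨ cong (λ' * a (suc m) +_) (sumTo-zero m (λ k _ → ℚₚ.*-zeroˡ (a (m ∸ k)))) ⟩
      λ' * a (suc m) + 0ℚ
        ≡⟨ ℚₚ.+-identityʳ (λ' * a (suc m)) ⟩
      λ' * a (suc m) ∎
      where open ≡-Reasoning

  1+λt-⊗-cancel : ∀ N {a b} → (1+λt ⊗ a) ≋[ N ] (1+λt ⊗ b) → a ≋[ N ] b
  1+λt-⊗-cancel N {a} {b} eq zero    _   =
    trans (sym (1+λt-⊗-zero a)) (trans (eq 0 z≤n) (1+λt-⊗-zero b))
  1+λt-⊗-cancel N {a} {b} eq (suc m) m<N = ∙-cancelʳ (λ' * b m) (a (suc m)) (b (suc m)) (begin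
    a (suc m) + λ' * b m     ≡⟨ cong (λ z → a (suc m) + λ' * z) aₘ≡bₘ ⟨
    a (suc m) + λ' * a m     ≡⟨ 1+λt-⊗-suc a m ⟨
    (1+λt ⊗ a) (suc m)       ≡⟨ eq (suc m) m<N ⟩
    (1+λt ⊗ b) (suc m)       ≡⟨ 1+λt-⊗-suc b m ⟩
    b (suc m) + λ' * b m     ∎)
    where
    open ≡-Reasoning
    aₘ≡bₘ : a m ≡ b m
    aₘ≡bₘ = 1+λt-⊗-cancel N {a} {b} eq m (ℕₚ.<⇒≤ m<N)

  1+λt-⊗-D : ∀ a m → (1+λt ⊗ D a) m ≡ ℕ→ℚ (suc m) * a (suc m) + λ' * (ℕ→ℚ m * a m)
  1+λt-⊗-D a zero    = begin
    (1+λt ⊗ D a) 0                      ≡⟨ 1+λt-⊗-zero (D a) ⟩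
    ℕ→ℚ 1 * a 1                         ≡⟨ ℚₚ.+-identityʳ (ℕ→ℚ 1 * a 1) ⟨
    ℕ→ℚ 1 * a 1 + 0ℚ                    ≡⟨ cong (ℕ→ℚ 1 * a 1 +_) (ℚₚ.*-zeroʳ λ') ⟨
    ℕ→ℚ 1 * a 1 + λ' * 0ℚ               ≡⟨ cong (λ z → ℕ→ℚ 1 * a 1 + λ' * z) (ℚₚ.*-zeroˡ (a 0)) ⟨
    ℕ→ℚ 1 * a 1 + λ' * (ℕ→ℚ 0 * a 0)    ∎
    where open ≡-Reasoning
  1+λt-⊗-D a (suc m) = 1+λt-⊗-suc (D a) m

  eλ-ode : ∀ y → (1+λt ⊗ D (eλ λ' y)) ≋ (y · eλ λ' y)
  eλ-ode y m = begin
    (1+λt ⊗ D (eλ λ' y)) m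
      ≡⟨ 1+λt-⊗-D (eλ λ' y) m ⟩
    ℕ→ℚ (suc m) * (d * (y - n * λ') * (recipSuc m * r)) + λ' * (n * (d * r))
      ≡⟨ regroup (ℕ→ℚ (suc m)) (recipSuc m) d y n λ' r ⟩
    (recipSuc m * ℕ→ℚ (suc m)) * (d * (y - n * λ') * r) + λ' * (n * (d * r))
      ≡⟨ cong (λ z → z * (d * (y - n * λ') * r) + λ' * (n * (d * r))) (recipSuc-inverseˡ m) ⟩
    1ℚ * (d * (y - n * λ') * r) + λ' * (n * (d * r))
      ≡⟨ collect d y n λ' r ⟩
    y * (d * r) ∎
    where
    open ≡-Reasoning
    d n r : ℚ
    d = dfall λ' y m
    n = ℕ→ℚ m
    r = recipFact m
    regroup : ∀ N s d y n l r → N * (d * (y - n * l) * (s * r)) + l * (n * (d * r))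
                                ≡ (s * N) * (d * (y - n * l) * r) + l * (n * (d * r))
    regroup = solve 7 (λ N s d y n l r → N :* (d :* (y :- n :* l) :* (s :* r)) :+ l :* (n :* (d :* r))
                                         := (s :* N) :* (d :* (y :- n :* l) :* r) :+ l :* (n :* (d :* r))) refl
    collect : ∀ d y n l r → 1ℚ * (d * (y - n * l) * r) + l * (n * (d * r)) ≡ y * (d * r)
    collect = solve 5 (λ d y n l r → con 1ℚ :* (d :* (y :- n :* l) :* r) :+ l :* (n :* (d :* r))
                                     := y :* (d :* r)) refl

  ode-unique : ∀ c {a b} → (1+λt ⊗ D a) ≋ (c · a) → (1+λt ⊗ D b) ≋ (c · b) → a 0 ≡ b 0 → a ≋ b
  ode-unique c {a} {b} a-ode b-ode a₀≡b₀ m = prefix m m ℕₚ.≤-refl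
    where
    prefix : ∀ N → a ≋[ N ] b
    prefix zero    zero _ = a₀≡b₀
    prefix (suc N)        = D-lift N a₀≡b₀ (1+λt-⊗-cancel N λ m m≤N →
      trans (a-ode m) (trans (cong (c *_) (prefix N m m≤N)) (sym (b-ode m))))

  eλ-+ : ∀ x y → (eλ λ' x ⊗ eλ λ' y) ≋ eλ λ' (x + y)
  eλ-+ x y = ode-unique (x + y) product-ode (eλ-ode (x + y)) refl
    where
    open ≡-Reasoning
    Ex Ey : Series
    Ex = eλ λ' x
    Ey = eλ λ' y
    product-ode : (1+λt ⊗ D (Ex ⊗ Ey)) ≋ ((x + y) · (Ex ⊗ Ey))
    product-ode m = begin
      (1+λt ⊗ D (Ex ⊗ Ey)) m
        ≡⟨ ⊗-congˡ 1+λt (D-⊗ Ex Ey) m ⟩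
      (1+λt ⊗ (D Ex ⊗ Ey ⊕ Ex ⊗ D Ey)) m
        ≡⟨ ⊗-distribˡ-⊕ 1+λt (D Ex ⊗ Ey) (Ex ⊗ D Ey) m ⟩
      (1+λt ⊗ (D Ex ⊗ Ey)) m + (1+λt ⊗ (Ex ⊗ D Ey)) m
        ≡⟨ cong₂ _+_ left right ⟩
      x * (Ex ⊗ Ey) m + y * (Ex ⊗ Ey) m
        ≡⟨ ℚₚ.*-distribʳ-+ ((Ex ⊗ Ey) m) x y ⟨
      (x + y) * (Ex ⊗ Ey) m ∎
      where
      left : (1+λt ⊗ (D Ex ⊗ Ey)) m ≡ x * (Ex ⊗ Ey) m
      left = begin
        (1+λt ⊗ (D Ex ⊗ Ey)) m    ≡⟨ ⊗-assoc 1+λt (D Ex) Ey m ⟨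
        ((1+λt ⊗ D Ex) ⊗ Ey) m    ≡⟨ ⊗-congʳ Ey (eλ-ode x) m ⟩
        ((x · Ex) ⊗ Ey) m         ≡⟨ ·-⊗ x Ex Ey m ⟩
        x * (Ex ⊗ Ey) m           ∎
      right : (1+λt ⊗ (Ex ⊗ D Ey)) m ≡ y * (Ex ⊗ Ey) m
      right = begin
        (1+λt ⊗ (Ex ⊗ D Ey)) m    ≡⟨ ⊗-assoc 1+λt Ex (D Ey) m ⟨
        ((1+λt ⊗ Ex) ⊗ D Ey) m    ≡⟨ ⊗-congʳ (D Ey) (⊗-comm 1+λt Ex) m ⟩
        ((Ex ⊗ 1+λt) ⊗ D Ey) m    ≡⟨ ⊗-assoc Ex 1+λt (D Ey) m ⟩
        (Ex ⊗ (1+λt ⊗ D Ey)) m    ≡⟨ ⊗-congˡ Ex (eλ-ode y) m ⟩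
        (Ex ⊗ (y · Ey)) m         ≡⟨ ⊗-· y Ex Ey m ⟩
        y * (Ex ⊗ Ey) m           ∎

  eλm1≋eλ1⊖1 : eλm1 λ' ≋ (eλ λ' 1ℚ ⊖ oneS)
  eλm1≋eλ1⊖1 zero    = refl
  eλm1≋eλ1⊖1 (suc m) = sym (ℚₚ.+-identityʳ (eλ λ' 1ℚ (suc m)))

  eλm1-⊗-eλ : ∀ x → (eλm1 λ' ⊗ eλ λ' x) ≋ (eλ λ' (1ℚ + x) ⊖ eλ λ' x)
  eλm1-⊗-eλ x m = begin
    (eλm1 λ' ⊗ eλ λ' x) m                              ≡⟨ ⊗-congʳ (eλ λ' x) eλm1≋eλ1⊖1 m ⟩
    ((eλ λ' 1ℚ ⊖ oneS) ⊗ eλ λ' x) m                    ≡⟨ ⊗-distribʳ-⊖ (eλ λ' 1ℚ) oneS (eλ λ' x) m ⟩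
    (eλ λ' 1ℚ ⊗ eλ λ' x) m - (oneS ⊗ eλ λ' x) m        ≡⟨ cong₂ _-_ (eλ-+ 1ℚ x m) (⊗-identityˡ (eλ λ' x) m) ⟩
    eλ λ' (1ℚ + x) m - eλ λ' x m                       ∎
    where open ≡-Reasoning

  powS-eλm1-⊗-eλ : ∀ n k x → ℕ→ℚ (fact n) * (sgn k * (powS (eλm1 λ') k ⊗ eλ λ' x) n)
                              ≡ altBinomSum (λ y → dfall λ' y n) k x
  powS-eλm1-⊗-eλ n zero x = begin
    f * (1ℚ * (oneS ⊗ eλ λ' x) n)
      ≡⟨ cong (λ z → f * (1ℚ * z)) (⊗-identityˡ (eλ λ' x) n) ⟩
    f * (1ℚ * (dfall λ' x n * recipFact n))
      ≡⟨ regroup f (dfall λ' x n) (recipFact n) ⟩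
    dfall λ' x n * (f * recipFact n)
      ≡⟨ cong (dfall λ' x n *_) (fact-recipFact n) ⟩
    dfall λ' x n * 1ℚ
      ≡⟨ ℚₚ.*-identityʳ (dfall λ' x n) ⟩
    dfall λ' x n
      ≡⟨ trans (ℚₚ.*-identityˡ _) (cong (λ y → dfall λ' y n) (ℚₚ.+-identityˡ x)) ⟨
    1ℚ * dfall λ' (0ℚ + x) n ∎
    where
    open ≡-Reasoning
    f : ℚ
    f = ℕ→ℚ (fact n)
    regroup : ∀ f d r → f * (1ℚ * (d * r)) ≡ d * (f * r)
    regroup = solve 3 (λ f d r → f :* (con 1ℚ :* (d :* r)) := d :* (f :* r)) refl
  powS-eλm1-⊗-eλ n (suc k) x = begin
    f * (sgn k * (- 1ℚ) * ((P ⊗ eλm1 λ') ⊗ eλ λ' x) n)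
      ≡⟨ cong (λ z → f * (sgn k * (- 1ℚ) * z)) difference ⟩
    f * (sgn k * (- 1ℚ) * ((P ⊗ eλ λ' (1ℚ + x)) n - (P ⊗ eλ λ' x) n))
      ≡⟨ expand f (sgn k) ((P ⊗ eλ λ' (1ℚ + x)) n) ((P ⊗ eλ λ' x) n) ⟩
    f * (sgn k * (P ⊗ eλ λ' x) n) - f * (sgn k * (P ⊗ eλ λ' (1ℚ + x)) n)
      ≡⟨ cong₂ _-_ (powS-eλm1-⊗-eλ n k x) (powS-eλm1-⊗-eλ n k (1ℚ + x)) ⟩
    altBinomSum h k x - altBinomSum h k (1ℚ + x)
      ≡⟨ altBinomSum-suc h k x ⟨
    altBinomSum h (suc k) x ∎
    where
    open ≡-Reasoning
    f : ℚ
    f = ℕ→ℚ (fact n)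
    P : Series
    P = powS (eλm1 λ') k
    h : ℚ → ℚ
    h y = dfall λ' y n
    difference : ((P ⊗ eλm1 λ') ⊗ eλ λ' x) n ≡ (P ⊗ eλ λ' (1ℚ + x)) n - (P ⊗ eλ λ' x) n
    difference = trans (⊗-assoc P (eλm1 λ') (eλ λ' x) n)
                 (trans (⊗-congˡ P (eλm1-⊗-eλ x) n) (⊗-distribˡ-⊖ P (eλ λ' (1ℚ + x)) (eλ λ' x) n))
    expand : ∀ f s A B → f * ((s * (- 1ℚ)) * (A - B)) ≡ f * (s * B) - f * (s * A)
    expand = solve 4 (λ f s A B → f :* ((s :* con (- 1ℚ)) :* (A :- B))
                                  := f :* (s :* B) :- f :* (s :* A)) refl

  stirling-term : ∀ n k x → sgn k * recipSuc k * ℕ→ℚ (fact k) * S₂ λ' n k x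
                            ≡ ℕ→ℚ (fact n) * (sgn k * recipSuc k * (powS (eλm1 λ') k ⊗ eλ λ' x) n)
  stirling-term n k x = begin
    s * r * ℕ→ℚ (fact k) * (ℕ→ℚ (fact n) * (recipFact k * c))
      ≡⟨ regroup s r (ℕ→ℚ (fact k)) (ℕ→ℚ (fact n)) (recipFact k) c ⟩
    ℕ→ℚ (fact n) * (s * r * c) * (ℕ→ℚ (fact k) * recipFact k)
      ≡⟨ cong (ℕ→ℚ (fact n) * (s * r * c) *_) (fact-recipFact k) ⟩
    ℕ→ℚ (fact n) * (s * r * c) * 1ℚ
      ≡⟨ ℚₚ.*-identityʳ _ ⟩
    ℕ→ℚ (fact n) * (s * r * c) ∎
    where
    open ≡-Reasoning
    s r c : ℚ
    s = sgn k
    r = recipSuc k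
    c = (powS (eλm1 λ') k ⊗ eλ λ' x) n
    regroup : ∀ s r fk fn rk c → s * r * fk * (fn * (rk * c)) ≡ fn * (s * r * c) * (fk * rk)
    regroup = solve 6 (λ s r fk fn rk c → s :* r :* fk :* (fn :* (rk :* c))
                                          := fn :* (s :* r :* c) :* (fk :* rk)) refl

  stirling-altBinomSum : ∀ n x k → sgn k * recipSuc k * ℕ→ℚ (fact k) * S₂ λ' n k x
                                   ≡ recipSuc k * altBinomSum (λ y → dfall λ' y n) k x
  stirling-altBinomSum n x k = begin
    sgn k * recipSuc k * ℕ→ℚ (fact k) * S₂ λ' n k x
      ≡⟨ stirling-term n k x ⟩
    ℕ→ℚ (fact n) * (sgn k * recipSuc k * c)
      ≡⟨ regroup (ℕ→ℚ (fact n)) (sgn k) (recipSuc k) c ⟩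
    recipSuc k * (ℕ→ℚ (fact n) * (sgn k * c))
      ≡⟨ cong (recipSuc k *_) (powS-eλm1-⊗-eλ n k x) ⟩
    recipSuc k * altBinomSum (λ y → dfall λ' y n) k x ∎
    where
    open ≡-Reasoning
    c : ℚ
    c = (powS (eλm1 λ') k ⊗ eλ λ' x) n
    regroup : ∀ f s r c → f * (s * r * c) ≡ r * (f * (s * c))
    regroup = solve 4 (λ f s r c → f :* (s :* r :* c) := r :* (f :* (s :* c))) refl

  -- Truncations at U^K of log(1 + U)/U and 1/(1 + U), where U = e_λ(t) - 1.
  logPartial : ℕ → Series
  logPartial K = sumS K (λ k → (sgn k * recipSuc k) · powS (eλm1 λ') k)

  geomPartial : ℕ → Series
  geomPartial K = sumS K (λ k → sgn k · powS (eλm1 λ') k)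

  eλ1≋1⊕eλm1 : eλ λ' 1ℚ ≋ (oneS ⊕ eλm1 λ')
  eλ1≋1⊕eλm1 zero    = refl
  eλ1≋1⊕eλm1 (suc m) = sym (ℚₚ.+-identityˡ (eλ λ' 1ℚ (suc m)))

  geomPartial-⊗-eλ1 : ∀ K → (geomPartial K ⊗ eλ λ' 1ℚ) ≋ (oneS ⊕ sgn K · powS (eλm1 λ') (suc K))
  geomPartial-⊗-eλ1 K m = begin
    (geomPartial K ⊗ eλ λ' 1ℚ) m
      ≡⟨ sumS-⊗ K (λ k → sgn k · P k) (eλ λ' 1ℚ) m ⟩
    sumTo K (λ k → ((sgn k · P k) ⊗ eλ λ' 1ℚ) m)
      ≡⟨ sumTo-cong K (λ k → trans (·-⊗ (sgn k) (P k) (eλ λ' 1ℚ) m) (cong (sgn k *_) (next k))) ⟩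
    sumTo K (λ k → sgn k * (P k m + P (suc k) m))
      ≡⟨ sumTo-alternating-telescope K (λ k → P k m) ⟩
    oneS m + sgn K * P (suc K) m ∎
    where
    open ≡-Reasoning
    P : ℕ → Series
    P = powS (eλm1 λ')
    next : ∀ k → (P k ⊗ eλ λ' 1ℚ) m ≡ P k m + P (suc k) m
    next k = trans (⊗-congˡ (P k) eλ1≋1⊕eλm1 m)
             (trans (⊗-distribˡ-⊕ (P k) oneS (eλm1 λ') m) (cong (_+ P (suc k) m) (⊗-identityʳ (P k) m)))

  D-logPartial-⊗ : ∀ K → D (logPartial K ⊗ eλm1 λ') ≋ (geomPartial K ⊗ D (eλm1 λ'))
  D-logPartial-⊗ K m = begin
    D (logPartial K ⊗ U) m
      ≡⟨ D-cong (sumS-⊗ K (λ k → c k · P k) U) m ⟩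
    D (sumS K (λ k → (c k · P k) ⊗ U)) m
      ≡⟨ D-sumS K (λ k → (c k · P k) ⊗ U) m ⟩
    sumTo K (λ k → D ((c k · P k) ⊗ U) m)
      ≡⟨ sumTo-cong K term ⟩
    sumTo K (λ k → ((sgn k · P k) ⊗ D U) m)
      ≡⟨ sumS-⊗ K (λ k → sgn k · P k) (D U) m ⟨
    (geomPartial K ⊗ D U) m ∎
    where
    open ≡-Reasoning
    U : Series
    U = eλm1 λ'
    P : ℕ → Series
    P = powS U
    c : ℕ → ℚ
    c k = sgn k * recipSuc k
    regroup : ∀ s r n y → s * r * (n * y) ≡ s * (r * n) * y
    regroup = solve 4 (λ s r n y → s :* r :* (n :* y) := s :* (r :* n) :* y) refl
    term : ∀ k → D ((c k · P k) ⊗ U) m ≡ ((sgn k · P k) ⊗ D U) m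
    term k = begin
      D ((c k · P k) ⊗ U) m                            ≡⟨ D-cong (·-⊗ (c k) (P k) U) m ⟩
      D (c k · P (suc k)) m                            ≡⟨ D-· (c k) (P (suc k)) m ⟩
      c k * D (P (suc k)) m                            ≡⟨ cong (c k *_) (D-powS U k m) ⟩
      c k * (ℕ→ℚ (suc k) * (P k ⊗ D U) m)              ≡⟨ regroup (sgn k) (recipSuc k) (ℕ→ℚ (suc k)) _ ⟩
      sgn k * (recipSuc k * ℕ→ℚ (suc k)) * (P k ⊗ D U) m ≡⟨ cong (λ z → sgn k * z * (P k ⊗ D U) m) (recipSuc-inverseˡ k) ⟩
      sgn k * 1ℚ * (P k ⊗ D U) m                       ≡⟨ cong (_* (P k ⊗ D U) m) (ℚₚ.*-identityʳ (sgn k)) ⟩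
      sgn k * (P k ⊗ D U) m                            ≡⟨ ·-⊗ (sgn k) (P k) (D U) m ⟨
      ((sgn k · P k) ⊗ D U) m                          ∎

  D-shift-logq/t : ∀ m → D (shift (logq/t λ')) m ≡ pow (- λ') m
  D-shift-logq/t m = begin
    ℕ→ℚ (suc m) * (pow (- λ') m * recipSuc m)      ≡⟨ x∙yz≈zx∙y (ℕ→ℚ (suc m)) (pow (- λ') m) (recipSuc m) ⟩
    (recipSuc m * ℕ→ℚ (suc m)) * pow (- λ') m      ≡⟨ cong (_* pow (- λ') m) (recipSuc-inverseˡ m) ⟩
    1ℚ * pow (- λ') m                              ≡⟨ ℚₚ.*-identityˡ (pow (- λ') m) ⟩
    pow (- λ') m                                   ∎
    where open ≡-Reasoning

  1+λt-⊗-D-log : (1+λt ⊗ D (shift (logq/t λ'))) ≋ oneS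
  1+λt-⊗-D-log zero    = trans (1+λt-⊗-zero (D (shift (logq/t λ')))) (D-shift-logq/t 0)
  1+λt-⊗-D-log (suc m) = begin
    (1+λt ⊗ D (shift (logq/t λ'))) (suc m)
      ≡⟨ 1+λt-⊗-suc (D (shift (logq/t λ'))) m ⟩
    D (shift (logq/t λ')) (suc m) + λ' * D (shift (logq/t λ')) m
      ≡⟨ cong₂ (λ u v → u + λ' * v) (D-shift-logq/t (suc m)) (D-shift-logq/t m) ⟩
    pow (- λ') m * (- λ') + λ' * pow (- λ') m
      ≡⟨ solve 2 (λ p l → p :* (:- l) :+ l :* p := con 0ℚ) refl (pow (- λ') m) λ' ⟩
    0ℚ ∎
    where open ≡-Reasoning

  1+λt-⊗-D-eλm1 : (1+λt ⊗ D (eλm1 λ')) ≋ eλ λ' 1ℚ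
  1+λt-⊗-D-eλm1 m = trans (eλ-ode 1ℚ m) (ℚₚ.*-identityˡ (eλ λ' 1ℚ m))

  log-expansion : ∀ n → shift (logq/t λ') ≋[ suc n ] (logPartial n ⊗ eλm1 λ')
  log-expansion n = D-lift n (sym (ℚₚ.*-zeroʳ (logPartial n 0))) (1+λt-⊗-cancel n same-image)
    where
    U : Series
    U = eλm1 λ'
    same-image : (1+λt ⊗ D (shift (logq/t λ'))) ≋[ n ] (1+λt ⊗ D (logPartial n ⊗ U))
    same-image m m≤n = begin
      (1+λt ⊗ D (shift (logq/t λ'))) m
        ≡⟨ 1+λt-⊗-D-log m ⟩
      oneS m
        ≡⟨ ℚₚ.+-identityʳ (oneS m) ⟨
      oneS m + 0ℚ
        ≡⟨ cong (oneS m +_) (ℚₚ.*-zeroʳ (sgn n)) ⟨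
      oneS m + sgn n * 0ℚ
        ≡⟨ cong (λ z → oneS m + sgn n * z) (powS-vanish U refl (suc n) m (s≤s m≤n)) ⟨
      oneS m + sgn n * powS U (suc n) m
        ≡⟨ geomPartial-⊗-eλ1 n m ⟨
      (geomPartial n ⊗ eλ λ' 1ℚ) m
        ≡⟨ ⊗-congˡ (geomPartial n) 1+λt-⊗-D-eλm1 m ⟨
      (geomPartial n ⊗ (1+λt ⊗ D U)) m
        ≡⟨ ⊗-assoc (geomPartial n) 1+λt (D U) m ⟨
      ((geomPartial n ⊗ 1+λt) ⊗ D U) m
        ≡⟨ ⊗-congʳ (D U) (⊗-comm (geomPartial n) 1+λt) m ⟩
      ((1+λt ⊗ geomPartial n) ⊗ D U) m
        ≡⟨ ⊗-assoc 1+λt (geomPartial n) (D U) m ⟩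
      (1+λt ⊗ (geomPartial n ⊗ D U)) m
        ≡⟨ ⊗-congˡ 1+λt (D-logPartial-⊗ n) m ⟨
      (1+λt ⊗ D (logPartial n ⊗ U)) m ∎
      where open ≡-Reasoning

  bernoulli-factor : ∀ n → (logq/t λ' ⊗ invS (eλm1/t λ')) ≋[ n ] logPartial n
  bernoulli-factor n m m≤n = begin
    (logq/t λ' ⊗ W) m                      ≡⟨ ⊗-congʳ≤ n W log≋ m m≤n ⟩
    ((logPartial n ⊗ V) ⊗ W) m             ≡⟨ ⊗-assoc (logPartial n) V W m ⟩
    (logPartial n ⊗ (V ⊗ W)) m             ≡⟨ ⊗-congˡ (logPartial n) (invS-inverseʳ V V₀≡1) m ⟩
    (logPartial n ⊗ oneS) m                ≡⟨ ⊗-identityʳ (logPartial n) m ⟩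
    logPartial n m                         ∎
    where
    open ≡-Reasoning
    V W : Series
    V = eλm1/t λ'
    W = invS V
    V₀≡1 : V 0 ≡ 1ℚ
    V₀≡1 = cong (λ z → (1ℚ * (1ℚ - z)) * (recipSuc 0 * 1ℚ)) (ℚₚ.*-zeroˡ λ')
    eλm1≋shiftV : eλm1 λ' ≋ shift V
    eλm1≋shiftV zero    = refl
    eλm1≋shiftV (suc m) = refl
    log≋ : logq/t λ' ≋[ n ] (logPartial n ⊗ V)
    log≋ m m≤n = begin
      shift (logq/t λ') (suc m)                ≡⟨ log-expansion n (suc m) (s≤s m≤n) ⟩
      (logPartial n ⊗ eλm1 λ') (suc m)         ≡⟨ ⊗-congˡ (logPartial n) eλm1≋shiftV (suc m) ⟩
      (logPartial n ⊗ shift V) (suc m)         ≡⟨ shift-⊗ (logPartial n) V (suc m) ⟩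
      (logPartial n ⊗ V) m                     ∎

  bernoulli-stirling : ∀ x n → β λ' x n ≡ sumTo n (λ k → sgn k * recipSuc k * ℕ→ℚ (fact k) * S₂ λ' n k x)
  bernoulli-stirling x n = begin
    f * (((logq/t λ' ⊗ invS (eλm1/t λ')) ⊗ eλ λ' x) n)
      ≡⟨ cong (f *_) (⊗-congʳ≤ n (eλ λ' x) (bernoulli-factor n) n ℕₚ.≤-refl) ⟩
    f * (logPartial n ⊗ eλ λ' x) n
      ≡⟨ cong (f *_) (sumS-⊗ n (λ k → c k · P k) (eλ λ' x) n) ⟩
    f * sumTo n (λ k → ((c k · P k) ⊗ eλ λ' x) n)
      ≡⟨ sumTo-*ˡ n f (λ k → ((c k · P k) ⊗ eλ λ' x) n) ⟩
    sumTo n (λ k → f * ((c k · P k) ⊗ eλ λ' x) n)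
      ≡⟨ sumTo-cong n (λ k → trans (cong (f *_) (·-⊗ (c k) (P k) (eλ λ' x) n)) (sym (stirling-term n k x))) ⟩
    sumTo n (λ k → sgn k * recipSuc k * ℕ→ℚ (fact k) * S₂ λ' n k x) ∎
    where
    open ≡-Reasoning
    f : ℚ
    f = ℕ→ℚ (fact n)
    P : ℕ → Series
    P = powS (eλm1 λ')
    c : ℕ → ℚ
    c k = sgn k * recipSuc k

theorem6 : (λ' x : ℚ) (n : ℕ) →
    (β λ' x n ≡ sumTo n (λ k → sgn k * recipSuc k * ℕ→ℚ (fact k) * S₂ λ' n k x))
    × (sumTo n (λ k → sgn k * recipSuc k * ℕ→ℚ (fact k) * S₂ λ' n k x)
       ≡ sumTo n (λ k → recipSuc k * sumTo k (λ l → ℕ→ℚ (k C l) * sgn l * dfall λ' (ℕ→ℚ l + x) n)))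
theorem6 λ' x n = bernoulli-stirling λ' x n , sumTo-cong n (stirling-altBinomSum λ' n x)
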